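{- Let $q$ be odd and consider $f(X)=EX^2+CX^{2q}+DX^{2q^2}\in\mathbb{F}_q[X]$ with $C,D,E\in\mathbb{F}_q$. If $C^3+D^3+E^3-3CDE=2^{ -1}$, then $f(X)$ is planar over $\mathbb{F}_{q^3}$.
   Context: $q$ is a power of an odd prime. For $q$ odd, a function $f:\mathbb{F}_{q^n}\to\mathbb{F}_{q^n}$ is called planar (over $\mathbb{F}_{q^n}$) if for every $\epsilon\in\mathbb{F}_{q^n}^*$ the polynomial $f(X+\epsilon)-f(X)$ induces a permutation of $\mathbb{F}_{q^n}$. -}

module Defs where

open import Level using (Level; _⊔_)
open import Data.Nat using (ℕ; zero; suc)
open import Data.Fin using (Fin)
open import Data.Product using (∃; _×_)
open import Relation.Nullary using (¬_)
open import Algebra.Bundles using (CommutativeRing)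
open import Function.Bundles using (Bijection)
open import Function.Definitions using (Injective; Surjective)
import Relation.Binary.PropositionalEquality as ≡

private variable c ℓ : Level

module _ (R : CommutativeRing c ℓ) where
  open CommutativeRing R

  pow : Carrier → ℕ → Carrier
  pow x zero    = 1#
  pow x (suc n) = x * pow x n

  record IsField : Set (c ⊔ ℓ) where
    field
      0≉1 : ¬ (0# ≈ 1#)
      inv : ∀ x → ¬ (x ≈ 0#) → ∃ λ y → x * y ≈ 1#

  HasOrder : ℕ → Set (c ⊔ ℓ)
  HasOrder N = Bijection setoid (≡.setoid (Fin N))

  IsPermutation : (Carrier → Carrier) → Set (c ⊔ ℓ)
  IsPermutation g = Injective _≈_ _≈_ g × Surjective _≈_ _≈_ g

  Planar : (Carrier → Carrier) → Set (c ⊔ ℓ)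
  Planar f = ∀ ε → ¬ (ε ≈ 0#) → IsPermutation (λ x → f (x + ε) - f x)

-- f(x) = ℒ(x²) for the linearized polynomial ℒ(w) = E w + C w^q + D w^(q²). On a field with q³
-- elements the Frobenius φ(x) = x^q is additive and multiplicative with φ³ = id and fixes C, D, E,
-- so ℒ is additive and f(x + ε) − f(x) = ℒ(2εx + ε²). If ℒ(a) = 0, applying φ twice gives a
-- circulant system in (a, φa, φ²a) whose determinant C³ + D³ + E³ − 3CDE is a unit (twice it is 1),
-- so a = 0. Hence every difference map is injective, and so bijective on the finite field.
module Submission where

open import Defs
open import Level using (Level)
open import Data.Nat using (ℕ; zero; suc)
import Data.Nat as ℕ
import Data.Nat.Properties as ℕ
open import Data.Nat.Divisibility using (_∣_; divides; >⇒∤)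
open import Data.Nat.Primality using (Prime; euclidsLemma)
open import Data.Nat.Tactic.RingSolver using (solve-∀)
open import Data.Fin using (Fin; zero; suc; punchOut; toℕ; inject₁; fromℕ)
open import Data.Fin.Properties
  using (any?; punchOut-injective; <⇒notInjective; suc-injective; toℕ<n; toℕ-inject₁; toℕ-fromℕ)
open import Data.Fin.Permutation using (permutation)
open import Data.Bool using (if_then_else_)
open import Data.Empty using (⊥-elim)
open import Data.Product using (∃; _×_; _,_; proj₁; proj₂)
open import Data.Sum using (inj₁; inj₂)
open import Function using (_∘_; id)
open import Function.Bundles using (Bijection)
open import Function.Definitions using (Congruent; Injective; Surjective; StrictlySurjective)
open import Relation.Nullary using (¬_; yes; no)
import Relation.Nullary.Decidable as Dec
open import Relation.Binary using (Setoid; Decidable)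
open import Relation.Binary.PropositionalEquality as ≡ using (_≡_; _≢_)
open import Algebra.Bundles using (CommutativeMonoid; CommutativeSemiring; CommutativeRing)
import Algebra.Properties.CommutativeMonoid.Sum as MonoidSum
import Algebra.Properties.Group as GroupProperties

private variable ℓ₁ ℓ₂ ℓ₃ ℓ₄ : Level

injective⇒strictlySurjective : ∀ {n} {h : Fin n → Fin n} →
  Injective _≡_ _≡_ h → StrictlySurjective _≡_ h
injective⇒strictlySurjective {suc m} {h} h-inj j with any? (λ i → h i Data.Fin.≟ j)
... | yes hit = hit
... | no miss = ⊥-elim (<⇒notInjective ℕ.≤-refl h∖j-injective)
  where
  h∖j : Fin (suc m) → Fin m
  h∖j i = punchOut {i = j} (λ j≡hi → miss (i , ≡.sym j≡hi))

  h∖j-injective : Injective _≡_ _≡_ h∖j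
  h∖j-injective = h-inj ∘ punchOut-injective {i = j} _ _

module _ (M : CommutativeMonoid ℓ₁ ℓ₂) where
  open CommutativeMonoid M
  open MonoidSum M

  sum-supportedAt : ∀ {n} (f : Fin n → Carrier) i → (∀ j → j ≢ i → f j ≈ ε) → sum f ≈ f i
  sum-supportedAt {suc n} f zero off = trans (∙-congˡ rest≈ε) (identityʳ _)
    where rest≈ε = trans (sum-cong-≋ (λ j → off (suc j) λ ())) (sum-replicate-zero n)
  sum-supportedAt f (suc i) off = trans (∙-congʳ (off zero λ ())) (trans (identityˡ _)
    (sum-supportedAt (f ∘ suc) i (λ j j≢i → off (suc j) (j≢i ∘ suc-injective))))

module FiniteSetoid {S : Setoid ℓ₁ ℓ₂} {n : ℕ} (enum : Bijection S (≡.setoid (Fin n))) where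
  open Setoid S
  open Bijection enum using (to; injective; strictlySurjective) renaming (cong to to-cong)

  from : Fin n → Carrier
  from i = proj₁ (strictlySurjective i)

  to-from : ∀ i → to (from i) ≡ i
  to-from i = proj₂ (strictlySurjective i)

  from-to : ∀ x → from (to x) ≈ x
  from-to x = injective (to-from (to x))

  to-≈from : ∀ {x i} → x ≈ from i → to x ≡ i
  to-≈from {i = i} x≈from-i = ≡.trans (to-cong x≈from-i) (to-from i)

  infix 4 _≟_
  _≟_ : Decidable _≈_
  x ≟ y = Dec.map′ injective to-cong (to x Data.Fin.≟ to y)

  injective⇒surjective : ∀ {f} → Congruent _≈_ _≈_ f → Injective _≈_ _≈_ f → Surjective _≈_ _≈_ f
  injective⇒surjective {f} f-cong f-inj y = from i , λ z≈from-i → trans (f-cong z≈from-i) (injective fi≡y)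
    where
    f′ : Fin n → Fin n
    f′ = to ∘ f ∘ from

    f′-injective : Injective _≡_ _≡_ f′
    f′-injective {i} {j} f′i≡f′j = ≡.trans (≡.sym (to-from i)) (to-≈from (f-inj (injective f′i≡f′j)))

    i = proj₁ (injective⇒strictlySurjective f′-injective (to y))
    fi≡y = proj₂ (injective⇒strictlySurjective f′-injective (to y))

  module _ (M : CommutativeMonoid ℓ₃ ℓ₄) where
    private module M = CommutativeMonoid M
    open MonoidSum M using (sum; ∑-permute; sum-cong-≋)

    ∑ : (Carrier → M.Carrier) → M.Carrier
    ∑ h = sum (h ∘ from)

    module _ (h : Carrier → M.Carrier) (h-cong : ∀ {x y} → x ≈ y → h x M.≈ h y) where

      ∑-reindex : ∀ σ σ⁻¹ → Congruent _≈_ _≈_ σ → Congruent _≈_ _≈_ σ⁻¹ →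
                  (∀ x → σ (σ⁻¹ x) ≈ x) → (∀ x → σ⁻¹ (σ x) ≈ x) → ∑ h M.≈ ∑ (h ∘ σ)
      ∑-reindex σ σ⁻¹ σ-cong σ⁻¹-cong σ∘σ⁻¹ σ⁻¹∘σ =
        M.trans (∑-permute (h ∘ from) π) (sum-cong-≋ (λ i → h-cong (from-to (σ (from i)))))
        where
        π = permutation (to ∘ σ ∘ from) (to ∘ σ⁻¹ ∘ from)
          (λ i → to-≈from (trans (σ-cong (from-to _)) (σ∘σ⁻¹ (from i))))
          (λ i → to-≈from (trans (σ⁻¹-cong (from-to _)) (σ⁻¹∘σ (from i))))

      ∑-supportedAt : ∀ x₀ → (∀ x → ¬ x ≈ x₀ → h x M.≈ M.ε) → ∑ h M.≈ h x₀
      ∑-supportedAt x₀ off = M.trans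
        (sum-supportedAt M (h ∘ from) (to x₀)
          (λ j j≢to-x₀ → off (from j) (j≢to-x₀ ∘ ≡.sym ∘ to-≈from ∘ sym)))
        (h-cong (from-to x₀))

module FieldProperties {c ℓ} (F : CommutativeRing c ℓ) (isField : IsField F) where
  open CommutativeRing F hiding (zero)
  open IsField isField
  open import Relation.Binary.Reasoning.Setoid setoid
  private module Π = MonoidSum *-commutativeMonoid

  *-invertible : ∀ {a} → a ≉ 0# →
                 ∃ λ a⁻¹ → (∀ x → a * (a⁻¹ * x) ≈ x) × (∀ x → a⁻¹ * (a * x) ≈ x)
  *-invertible {a} a≉0 with inv a a≉0
  ... | a⁻¹ , aa⁻¹≈1 = a⁻¹ , cancel aa⁻¹≈1 , cancel (trans (*-comm a⁻¹ a) aa⁻¹≈1)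
    where
    cancel : ∀ {u v} → u * v ≈ 1# → ∀ x → u * (v * x) ≈ x
    cancel {u} {v} uv≈1 x = begin
      u * (v * x) ≈⟨ *-assoc u v x ⟨
      u * v * x   ≈⟨ *-congʳ uv≈1 ⟩
      1# * x      ≈⟨ *-identityˡ x ⟩
      x           ∎

  *-cancelˡ : ∀ {a x y} → a ≉ 0# → a * x ≈ a * y → x ≈ y
  *-cancelˡ {a} {x} {y} a≉0 ax≈ay with *-invertible a≉0
  ... | a⁻¹ , _ , a⁻¹[ax]≈x = begin
    x             ≈⟨ a⁻¹[ax]≈x x ⟨
    a⁻¹ * (a * x) ≈⟨ *-congˡ ax≈ay ⟩
    a⁻¹ * (a * y) ≈⟨ a⁻¹[ax]≈x y ⟩
    y             ∎

  xy≈0⇒y≈0 : ∀ {x y} → x ≉ 0# → x * y ≈ 0# → y ≈ 0#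
  xy≈0⇒y≈0 {x} x≉0 xy≈0 = *-cancelˡ x≉0 (trans xy≈0 (sym (zeroʳ x)))

  *-nonzero : ∀ {x y} → x ≉ 0# → y ≉ 0# → x * y ≉ 0#
  *-nonzero x≉0 y≉0 = y≉0 ∘ xy≈0⇒y≈0 x≉0

  ∏-nonzero : ∀ {n} (f : Fin n → Carrier) → (∀ i → f i ≉ 0#) → Π.sum f ≉ 0#
  ∏-nonzero {zero}  f f≉0 1≈0 = 0≉1 (sym 1≈0)
  ∏-nonzero {suc n} f f≉0 = *-nonzero (f≉0 zero) (∏-nonzero (f ∘ suc) (f≉0 ∘ suc))

module FiniteField {c ℓ} (F : CommutativeRing c ℓ) (isField : IsField F) {N : ℕ} (card : HasOrder F N) where
  open CommutativeRing F hiding (zero)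
  open FieldProperties F isField
  open FiniteSetoid card
  open import Algebra.Properties.Semiring.Exp semiring using (_^_; ^-congˡ)
  open import Algebra.Properties.Semiring.Mult semiring using (×-homo-1; ×1-homo-*) renaming (_×_ to _·_)
  open import Relation.Binary.Reasoning.Setoid setoid
  open GroupProperties +-group using (identityʳ-unique; //-rightDividesˡ; //-rightDividesʳ)
  open Bijection card using (to)
  private module Σ = MonoidSum +-commutativeMonoid
  private module Π = MonoidSum *-commutativeMonoid

  ∏ : (Carrier → Carrier) → Carrier
  ∏ = ∑ *-commutativeMonoid

  card·x≈0 : ∀ x → N · x ≈ 0#
  card·x≈0 x = identityʳ-unique (∑ᴬ id) (N · x) (sym (begin
    ∑ᴬ id                 ≈⟨ translated ⟩
    ∑ᴬ (_+ x)             ≈⟨ Σ.∑-distrib-+ from (λ _ → x) ⟩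
    ∑ᴬ id + ∑ᴬ (λ _ → x)  ≈⟨ +-congˡ (Σ.sum-replicate N) ⟩
    ∑ᴬ id + N · x         ∎))
    where
    ∑ᴬ = ∑ +-commutativeMonoid
    translated = ∑-reindex +-commutativeMonoid id (λ x≈y → x≈y) (_+ x) (_- x) +-congʳ +-congʳ
      (//-rightDividesˡ x) (//-rightDividesʳ x)

  ifZero : Carrier → Carrier → Carrier → Carrier
  ifZero y u v = if Dec.does (y ≟ 0#) then u else v

  ifZero-≈0 : ∀ {y} u v → y ≈ 0# → ifZero y u v ≡ u
  ifZero-≈0 {y} u v y≈0 = ≡.cong (λ b → if b then u else v) (Dec.dec-true (y ≟ 0#) y≈0)

  ifZero-≉0 : ∀ {y} u v → y ≉ 0# → ifZero y u v ≡ v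
  ifZero-≉0 {y} u v y≉0 = ≡.cong (λ b → if b then u else v) (Dec.dec-false (y ≟ 0#) y≉0)

  ifZero-cong : ∀ {x y u u′ v v′} → x ≈ y → u ≈ u′ → v ≈ v′ → ifZero x u v ≈ ifZero y u′ v′
  ifZero-cong {x} {u = u} {u′} {v} {v′} x≈y u≈u′ v≈v′ with x ≟ 0#
  ... | yes x≈0 = begin
    ifZero x u v   ≡⟨ ifZero-≈0 u v x≈0 ⟩
    u              ≈⟨ u≈u′ ⟩
    u′             ≡⟨ ifZero-≈0 u′ v′ (trans (sym x≈y) x≈0) ⟨
    ifZero _ u′ v′ ∎
  ... | no x≉0  = begin
    ifZero x u v   ≡⟨ ifZero-≉0 u v x≉0 ⟩
    v              ≈⟨ v≈v′ ⟩
    v′             ≡⟨ ifZero-≉0 u′ v′ (x≉0 ∘ trans x≈y) ⟨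
    ifZero _ u′ v′ ∎

  nonzeroPart : Carrier → Carrier
  nonzeroPart y = ifZero y 1# y

  nonzeroPart-nonzero : ∀ y → nonzeroPart y ≉ 0#
  nonzeroPart-nonzero y with y ≟ 0#
  ... | yes y≈0 = IsField.0≉1 isField ∘ sym ∘ trans (reflexive (≡.sym (ifZero-≈0 1# y y≈0)))
  ... | no y≉0  = y≉0 ∘ trans (reflexive (≡.sym (ifZero-≉0 1# y y≉0)))

  module _ {a} (a≉0 : a ≉ 0#) where

    scaledAtZero : Carrier → Carrier
    scaledAtZero y = ifZero y a 1#

    nonzeroPart-* : ∀ y → nonzeroPart (a * y) * scaledAtZero y ≈ a * nonzeroPart y
    nonzeroPart-* y with y ≟ 0#
    ... | yes y≈0 = begin
      nonzeroPart (a * y) * scaledAtZero y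
        ≡⟨ ≡.cong₂ _*_ (ifZero-≈0 1# (a * y) ay≈0) (ifZero-≈0 a 1# y≈0) ⟩
      1# * a                               ≈⟨ *-comm 1# a ⟩
      a * 1#                               ≡⟨ ≡.cong (a *_) (ifZero-≈0 1# y y≈0) ⟨
      a * nonzeroPart y                    ∎
      where ay≈0 = trans (*-congˡ y≈0) (zeroʳ a)
    ... | no y≉0 = begin
      nonzeroPart (a * y) * scaledAtZero y
        ≡⟨ ≡.cong₂ _*_ (ifZero-≉0 1# (a * y) (*-nonzero a≉0 y≉0)) (ifZero-≉0 a 1# y≉0) ⟩
      a * y * 1#                           ≈⟨ *-identityʳ _ ⟩
      a * y                                ≡⟨ ≡.cong (a *_) (ifZero-≉0 1# y y≉0) ⟨
      a * nonzeroPart y                    ∎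

    ∏-scaledAtZero : ∏ scaledAtZero ≈ a
    ∏-scaledAtZero = trans
      (∑-supportedAt *-commutativeMonoid scaledAtZero (λ x≈y → ifZero-cong x≈y refl refl) 0#
        (λ y y≉0 → reflexive (ifZero-≉0 a 1# y≉0)))
      (reflexive (ifZero-≈0 a 1# refl))

    -- Reindexing by y ↦ a y: only the factor at y = 0 does not pick up a, and scaledAtZero supplies it.
    ∏-nonzeroPart-* : ∏ nonzeroPart * a ≈ a ^ N * ∏ nonzeroPart
    ∏-nonzeroPart-* = begin
      ∏ nonzeroPart * a
        ≈⟨ *-cong reindexed (sym ∏-scaledAtZero) ⟩
      ∏ (nonzeroPart ∘ (a *_)) * ∏ scaledAtZero
        ≈⟨ Π.∑-distrib-+ (nonzeroPart ∘ (a *_) ∘ from) (scaledAtZero ∘ from) ⟨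
      ∏ (λ y → nonzeroPart (a * y) * scaledAtZero y)
        ≈⟨ Π.sum-cong-≋ (nonzeroPart-* ∘ from) ⟩
      ∏ (λ y → a * nonzeroPart y)
        ≈⟨ Π.∑-distrib-+ (λ _ → a) (nonzeroPart ∘ from) ⟩
      ∏ (λ _ → a) * ∏ nonzeroPart
        ≈⟨ *-congʳ (Π.sum-replicate N) ⟩
      a ^ N * ∏ nonzeroPart
        ∎
      where
      a⁻¹ = proj₁ (*-invertible a≉0)
      reindexed = ∑-reindex *-commutativeMonoid nonzeroPart (λ x≈y → ifZero-cong x≈y refl x≈y)
        (a *_) (a⁻¹ *_) *-congˡ *-congˡ (proj₁ (proj₂ (*-invertible a≉0))) (proj₂ (proj₂ (*-invertible a≉0)))

  [a^m]·1≈0⇒a·1≈0 : ∀ a m → (a ℕ.^ m) · 1# ≈ 0# → a · 1# ≈ 0#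
  [a^m]·1≈0⇒a·1≈0 a zero    1≈0 = ⊥-elim (IsField.0≉1 isField (sym (trans (sym (×-homo-1 1#)) 1≈0)))
  [a^m]·1≈0⇒a·1≈0 a (suc m) a^[1+m]·1≈0 with (a · 1#) ≟ 0#
  ... | yes a·1≈0 = a·1≈0
  ... | no a·1≉0  =
    [a^m]·1≈0⇒a·1≈0 a m (xy≈0⇒y≈0 a·1≉0 (trans (sym (×1-homo-* a (a ℕ.^ m))) a^[1+m]·1≈0))

  x^card≈x : ∀ x → x ^ N ≈ x
  x^card≈x x with x ≟ 0#
  ... | yes x≈0 = trans (^-congˡ N x≈0) (trans (0^nonempty (to 0#)) (sym x≈0))
    where
    0^nonempty : ∀ {n} → Fin n → 0# ^ n ≈ 0#
    0^nonempty {suc n} _ = zeroˡ _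
  ... | no x≉0  = *-cancelˡ (∏-nonzero (nonzeroPart ∘ from) (nonzeroPart-nonzero ∘ from))
    (trans (*-comm _ _) (sym (∏-nonzeroPart-* x≉0)))

-- Imported locally: a global _C_ would capture the coefficient name C used below.
module _ where
  open import Data.Nat.Combinatorics using (_C_; nC1≡n; nCk+nC[k+1]≡[n+1]C[k+1])

  [1+k]*[1+n]C[1+k]≡[1+n]*nCk : ∀ n k → suc k ℕ.* (suc n C suc k) ≡ suc n ℕ.* (n C k)
  [1+k]*[1+n]C[1+k]≡[1+n]*nCk zero    zero    = ≡.refl
  [1+k]*[1+n]C[1+k]≡[1+n]*nCk zero    (suc k) = ℕ.*-zeroʳ (suc (suc k))
  [1+k]*[1+n]C[1+k]≡[1+n]*nCk (suc n) zero    =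
    ≡.trans (ℕ.*-identityˡ _) (≡.trans (nC1≡n (suc (suc n))) (≡.sym (ℕ.*-identityʳ _)))
  [1+k]*[1+n]C[1+k]≡[1+n]*nCk (suc n) (suc k) = begin
    suc (suc k) ℕ.* (suc (suc n) C suc (suc k))
      ≡⟨ ≡.cong (suc (suc k) ℕ.*_) (nCk+nC[k+1]≡[n+1]C[k+1] (suc n) (suc k)) ⟨
    suc (suc k) ℕ.* (a ℕ.+ b)
      ≡⟨ regroup k a b ⟩
    a ℕ.+ suc k ℕ.* a ℕ.+ suc (suc k) ℕ.* b
      ≡⟨ ≡.cong₂ (λ u v → a ℕ.+ u ℕ.+ v) (ih k) (ih (suc k)) ⟩
    a ℕ.+ suc n ℕ.* (n C k) ℕ.+ suc n ℕ.* (n C suc k)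
      ≡⟨ ℕ.+-assoc a _ _ ⟩
    a ℕ.+ (suc n ℕ.* (n C k) ℕ.+ suc n ℕ.* (n C suc k))
      ≡⟨ ≡.cong (a ℕ.+_) (ℕ.*-distribˡ-+ (suc n) (n C k) (n C suc k)) ⟨
    a ℕ.+ suc n ℕ.* (n C k ℕ.+ n C suc k)
      ≡⟨ ≡.cong (λ u → a ℕ.+ suc n ℕ.* u) (nCk+nC[k+1]≡[n+1]C[k+1] n k) ⟩
    suc (suc n) ℕ.* a
      ∎
    where
    open ≡.≡-Reasoning
    a = suc n C suc k
    b = suc n C suc (suc k)
    ih = [1+k]*[1+n]C[1+k]≡[1+n]*nCk n
    regroup : ∀ k a b → suc (suc k) ℕ.* (a ℕ.+ b) ≡ a ℕ.+ suc k ℕ.* a ℕ.+ suc (suc k) ℕ.* b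
    regroup = solve-∀

  prime∣pCk : ∀ {p k} → Prime p → 0 ℕ.< k → k ℕ.< p → p ∣ p C k
  prime∣pCk {suc n} {suc j} p-prime _ k<p
    with euclidsLemma (suc j) (suc n C suc j) p-prime
           (divides (n C j) (≡.trans ([1+k]*[1+n]C[1+k]≡[1+n]*nCk n j) (ℕ.*-comm (suc n) (n C j))))
  ... | inj₁ p∣k     = ⊥-elim (>⇒∤ k<p p∣k)
  ... | inj₂ p∣pCk   = p∣pCk

module Frobenius {c ℓ} (S : CommutativeSemiring c ℓ) where
  open CommutativeSemiring S hiding (zero)
  open import Algebra.Properties.Semiring.Exp semiring using (_^_; ^-congˡ; ^-assocʳ)
  open import Algebra.Properties.Semiring.Mult semiring using (×-congʳ; ×-assoc-*; ×1-homo-*) renaming (_×_ to _·_)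
  open import Algebra.Properties.CommutativeSemiring.Binomial S using (theorem; binomialTerm)
  open import Data.Nat.Combinatorics using (_C_; nCn≡1)
  open import Relation.Binary.Reasoning.Setoid setoid
  module Σ = MonoidSum +-commutativeMonoid

  module _ {p} (char : p · 1# ≈ 0#) where

    ·-vanishes : ∀ {n} → p ∣ n → ∀ x → n · x ≈ 0#
    ·-vanishes (divides d ≡.refl) x = begin
      (d ℕ.* p) · x            ≈⟨ ×-congʳ (d ℕ.* p) (*-identityˡ x) ⟨
      (d ℕ.* p) · (1# * x)     ≈⟨ ×-assoc-* (d ℕ.* p) 1# x ⟨
      (d ℕ.* p) · 1# * x       ≈⟨ *-congʳ (×1-homo-* d p) ⟩
      (d · 1#) * (p · 1#) * x  ≈⟨ *-congʳ (*-congˡ char) ⟩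
      (d · 1#) * 0# * x        ≈⟨ *-congʳ (zeroʳ _) ⟩
      0# * x                   ≈⟨ zeroˡ x ⟩
      0#                       ∎

  ^p-distrib-+ : ∀ {p} → Prime p → p · 1# ≈ 0# → ∀ x y → (x + y) ^ p ≈ x ^ p + y ^ p
  ^p-distrib-+ {suc (suc n)} p-prime char x y = begin
    (x + y) ^ p                           ≈⟨ theorem p x y ⟩
    t zero + Σ.sum (t ∘ suc)              ≈⟨ +-congˡ (Σ.sum-init-last (t ∘ suc)) ⟩
    t zero + (Σ.sum interior + t last)    ≈⟨ +-cong first≈ (+-cong interior≈0 last≈) ⟩
    y ^ p + (0# + x ^ p)                  ≈⟨ +-comm _ _ ⟩
    0# + x ^ p + y ^ p                    ≈⟨ +-congʳ (+-identityˡ _) ⟩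
    x ^ p + y ^ p                         ∎
    where
    p = suc (suc n)
    t = binomialTerm x y p
    interior : Fin (suc n) → Carrier
    interior i = t (suc (inject₁ i))
    last = suc (fromℕ (suc n))

    first≈ : t zero ≈ y ^ p
    first≈ = trans (+-identityʳ _) (*-identityˡ _)

    last≈ : t last ≈ x ^ p
    last≈ rewrite toℕ-fromℕ n | nCn≡1 p | ℕ.n∸n≡0 p = trans (+-identityʳ _) (*-identityʳ _)

    interior≈0 : Σ.sum interior ≈ 0#
    interior≈0 = trans (Σ.sum-cong-≋ {x = interior} (λ i → ·-vanishes char (p∣pCi i) _)) (Σ.sum-replicate-zero (suc n))
      where
      p∣pCi : ∀ i → p ∣ p C toℕ (suc (inject₁ i))
      p∣pCi i = prime∣pCk p-prime (ℕ.s≤s ℕ.z≤n)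
        (ℕ.s≤s (≡.subst (ℕ._< suc n) (≡.sym (toℕ-inject₁ i)) (toℕ<n i)))

  ^[p^m]-distrib-+ : ∀ {p} → Prime p → p · 1# ≈ 0# →
                     ∀ m x y → (x + y) ^ (p ℕ.^ m) ≈ x ^ (p ℕ.^ m) + y ^ (p ℕ.^ m)
  ^[p^m]-distrib-+ p-prime char zero    x y = distribʳ 1# x y
  ^[p^m]-distrib-+ {p} p-prime char (suc m) x y = begin
    (x + y) ^ (p ℕ.* p ℕ.^ m)                 ≈⟨ ^-assocʳ (x + y) p (p ℕ.^ m) ⟨
    ((x + y) ^ p) ^ (p ℕ.^ m)                 ≈⟨ ^-congˡ (p ℕ.^ m) (^p-distrib-+ p-prime char x y) ⟩
    (x ^ p + y ^ p) ^ (p ℕ.^ m)               ≈⟨ ^[p^m]-distrib-+ p-prime char m (x ^ p) (y ^ p) ⟩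
    (x ^ p) ^ (p ℕ.^ m) + (y ^ p) ^ (p ℕ.^ m) ≈⟨ +-cong (^-assocʳ x p (p ℕ.^ m)) (^-assocʳ y p (p ℕ.^ m)) ⟩
    x ^ (p ℕ.* p ℕ.^ m) + y ^ (p ℕ.* p ℕ.^ m) ∎

module FrobeniusCube {c ℓ} (F : CommutativeRing c ℓ) (isField : IsField F) {p} (p-prime : Prime p) (m : ℕ)
  (card : HasOrder F ((p ℕ.^ m) ℕ.^ 3)) where
  open CommutativeRing F
  open FiniteField F isField card using (card·x≈0; [a^m]·1≈0⇒a·1≈0; x^card≈x)
  open import Algebra.Properties.Semiring.Mult semiring using () renaming (_×_ to _·_)
  open Frobenius commutativeSemiring using (^[p^m]-distrib-+)
  open import Algebra.Properties.Semiring.Exp semiring using (_^_; ^-congˡ; ^-assocʳ)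
  open import Algebra.Properties.CommutativeSemiring.Exp commutativeSemiring using (^-distrib-*)

  q : ℕ
  q = p ℕ.^ m

  φ : Carrier → Carrier
  φ x = x ^ q

  char : p · 1# ≈ 0#
  char = [a^m]·1≈0⇒a·1≈0 p m ([a^m]·1≈0⇒a·1≈0 q 3 (card·x≈0 1#))

  φ-cong : Congruent _≈_ _≈_ φ
  φ-cong = ^-congˡ q

  φ-+ : ∀ x y → φ (x + y) ≈ φ x + φ y
  φ-+ = ^[p^m]-distrib-+ p-prime char m

  φ-* : ∀ x y → φ (x * y) ≈ φ x * φ y
  φ-* x y = ^-distrib-* x y q

  φ∘φ≈^[q*q] : ∀ x → φ (φ x) ≈ x ^ (q ℕ.* q)
  φ∘φ≈^[q*q] x = ^-assocʳ x q q

  φ³≈id : ∀ x → φ (φ (φ x)) ≈ x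
  φ³≈id x = begin
    φ (φ (φ x))          ≈⟨ φ-cong (φ∘φ≈^[q*q] x) ⟩
    (x ^ (q ℕ.* q)) ^ q  ≈⟨ ^-assocʳ x (q ℕ.* q) q ⟩
    x ^ (q ℕ.* q ℕ.* q)  ≡⟨ ≡.cong (x ^_) (cube q) ⟩
    x ^ (q ℕ.^ 3)        ≈⟨ x^card≈x x ⟩
    x                    ∎
    where
    open import Relation.Binary.Reasoning.Setoid setoid
    cube : ∀ n → n ℕ.* n ℕ.* n ≡ n ℕ.* (n ℕ.* (n ℕ.* 1))
    cube = solve-∀

module _ {r ℓ} (R : CommutativeRing r ℓ) where
  open CommutativeRing R hiding (zero)
  open import Algebra.Properties.Semiring.Exp semiring using (_^_; ^-congˡ; ^-assocʳ)
  open import Relation.Binary.Reasoning.Setoid setoid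
  open import Algebra.Properties.AbelianGroup +-abelianGroup
    using (identityˡ-unique; ∙-cancelʳ; x≈z//y; //-rightDividesˡ; x∙y⁻¹≈ε⇒x≈y; x≈y⇒x∙y⁻¹≈ε; xyx⁻¹≈y)
  open import Algebra.Properties.Ring ring using ([y-z]x≈yx-zx)
  open import Algebra.Solver.Ring.NaturalCoefficients.Default commutativeSemiring
    using (solve; _:+_; _:*_; _:=_; con)

  two three : Carrier
  two = 1# + 1#
  three = 1# + 1# + 1#

  square-+ : ∀ x ε → (x + ε) * (x + ε) ≈ x * x + (two * ε * x + ε * ε)
  square-+ = solve 2 (λ x ε → (x :+ ε) :* (x :+ ε) := x :* x :+ ((con 1 :+ con 1) :* ε :* x :+ ε :* ε)) refl

  pow≡^ : ∀ x n → pow R x n ≡ x ^ n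
  pow≡^ x zero    = ≡.refl
  pow≡^ x (suc n) = ≡.cong (x *_) (pow≡^ x n)

  pow[x,2m]≈[x*x]^m : ∀ x m → pow R x (2 ℕ.* m) ≈ (x * x) ^ m
  pow[x,2m]≈[x*x]^m x m = begin
    pow R x (2 ℕ.* m) ≡⟨ pow≡^ x (2 ℕ.* m) ⟩
    x ^ (2 ℕ.* m)     ≈⟨ ^-assocʳ x 2 m ⟨
    (x ^ 2) ^ m       ≈⟨ ^-congˡ m (*-congˡ (*-identityʳ x)) ⟩
    (x * x) ^ m       ∎

  Planar-cong : ∀ {f g} → (∀ x → f x ≈ g x) → Planar R g → Planar R f
  Planar-cong {f} {g} f≈g g-planar ε ε≉0 = injective , surjective
    where
    Δf≈Δg : ∀ x → f (x + ε) - f x ≈ g (x + ε) - g x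
    Δf≈Δg x = +-cong (f≈g (x + ε)) (-‿cong (f≈g x))

    injective : Injective _≈_ _≈_ (λ x → f (x + ε) - f x)
    injective eq = proj₁ (g-planar ε ε≉0) (trans (sym (Δf≈Δg _)) (trans eq (Δf≈Δg _)))

    surjective : Surjective _≈_ _≈_ (λ x → f (x + ε) - f x)
    surjective y with proj₂ (g-planar ε ε≉0) y
    ... | x , hits = x , λ z≈x → trans (Δf≈Δg _) (hits z≈x)

  module Linearized (σ : Carrier → Carrier) (σ-cong : Congruent _≈_ _≈_ σ)
    (σ-+ : ∀ x y → σ (x + y) ≈ σ x + σ y) (σ-* : ∀ x y → σ (x * y) ≈ σ x * σ y)
    (σ³≈id : ∀ x → σ (σ (σ x)) ≈ x)
    (E C D : Carrier) (σE≈E : σ E ≈ E) (σC≈C : σ C ≈ C) (σD≈D : σ D ≈ D) where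

    combo : Carrier → Carrier → Carrier → Carrier
    combo u v w = E * u + C * v + D * w

    ℒ : Carrier → Carrier
    ℒ w = combo w (σ w) (σ (σ w))

    Δ : Carrier
    Δ = C ^ 3 + D ^ 3 + E ^ 3 - three * C * D * E

    combo-cong : ∀ {u u′ v v′ w w′} → u ≈ u′ → v ≈ v′ → w ≈ w′ → combo u v w ≈ combo u′ v′ w′
    combo-cong u≈u′ v≈v′ w≈w′ = +-cong (+-cong (*-congˡ u≈u′) (*-congˡ v≈v′)) (*-congˡ w≈w′)

    combo-+ : ∀ u v w u′ v′ w′ → combo (u + u′) (v + v′) (w + w′) ≈ combo u v w + combo u′ v′ w′
    combo-+ = solve 9 (λ E C D u v w u′ v′ w′ →
      E :* (u :+ u′) :+ C :* (v :+ v′) :+ D :* (w :+ w′) :=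
      (E :* u :+ C :* v :+ D :* w) :+ (E :* u′ :+ C :* v′ :+ D :* w′)) refl E C D

    σ-combo : ∀ u v w → σ (combo u v w) ≈ combo (σ u) (σ v) (σ w)
    σ-combo u v w = begin
      σ (E * u + C * v + D * w)
        ≈⟨ trans (σ-+ _ _) (+-congʳ (σ-+ _ _)) ⟩
      σ (E * u) + σ (C * v) + σ (D * w)
        ≈⟨ +-cong (+-cong (σ-* E u) (σ-* C v)) (σ-* D w) ⟩
      σ E * σ u + σ C * σ v + σ D * σ w
        ≈⟨ +-cong (+-cong (*-congʳ σE≈E) (*-congʳ σC≈C)) (*-congʳ σD≈D) ⟩
      E * σ u + C * σ v + D * σ w
        ∎

    σ0≈0 : σ 0# ≈ 0#
    σ0≈0 = identityˡ-unique (σ 0#) (σ 0#) (trans (sym (σ-+ 0# 0#)) (σ-cong (+-identityʳ 0#)))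

    ℒ-cong : Congruent _≈_ _≈_ ℒ
    ℒ-cong w≈w′ = combo-cong w≈w′ (σ-cong w≈w′) (σ-cong (σ-cong w≈w′))

    ℒ-+ : ∀ x y → ℒ (x + y) ≈ ℒ x + ℒ y
    ℒ-+ x y = trans (combo-cong refl (σ-+ x y) (trans (σ-cong (σ-+ x y)) (σ-+ _ _))) (combo-+ _ _ _ _ _ _)

    ℒ-homo-- : ∀ x y → ℒ (x - y) ≈ ℒ x - ℒ y
    ℒ-homo-- x y = x≈z//y (ℒ (x - y)) (ℒ y) (ℒ x)
      (trans (sym (ℒ-+ (x - y) y)) (ℒ-cong (//-rightDividesˡ y x)))

    ℒ-σ : ∀ w → ℒ (σ w) ≈ σ (ℒ w)
    ℒ-σ w = sym (σ-combo w (σ w) (σ (σ w)))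

    σ-preserves-kernel : ∀ {w} → ℒ w ≈ 0# → ℒ (σ w) ≈ 0#
    σ-preserves-kernel ℒw≈0 = trans (ℒ-σ _) (trans (σ-cong ℒw≈0) σ0≈0)

    -- (E² − CD, D² − CE, C² − DE) is the adjugate row of the circulant matrix of (E, C, D),
    -- split by sign so that the identity involves no subtraction.
    circulant-adjugate : ∀ a b c →
      E * E * combo a b c + D * D * combo b c a + C * C * combo c a b + three * C * D * E * a ≈
      C * D * combo a b c + C * E * combo b c a + D * E * combo c a b + (C ^ 3 + D ^ 3 + E ^ 3) * a
    circulant-adjugate = solve 6 (λ E C D a b c →
      E :* E :* (E :* a :+ C :* b :+ D :* c) :+ D :* D :* (E :* b :+ C :* c :+ D :* a)
        :+ C :* C :* (E :* c :+ C :* a :+ D :* b) :+ (con 1 :+ con 1 :+ con 1) :* C :* D :* E :* a :=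
      C :* D :* (E :* a :+ C :* b :+ D :* c) :+ C :* E :* (E :* b :+ C :* c :+ D :* a)
        :+ D :* E :* (E :* c :+ C :* a :+ D :* b)
        :+ (C :* (C :* (C :* con 1)) :+ D :* (D :* (D :* con 1)) :+ E :* (E :* (E :* con 1))) :* a)
      refl E C D

    combo-zero : ∀ α β γ {u v w} → u ≈ 0# → v ≈ 0# → w ≈ 0# → α * u + β * v + γ * w ≈ 0#
    combo-zero α β γ u≈0 v≈0 w≈0 = begin
      α * _ + β * _ + γ * _    ≈⟨ +-cong (+-cong (*-congˡ u≈0) (*-congˡ v≈0)) (*-congˡ w≈0) ⟩
      α * 0# + β * 0# + γ * 0# ≈⟨ +-cong (+-cong (zeroʳ α) (zeroʳ β)) (zeroʳ γ) ⟩
      0# + 0# + 0#             ≈⟨ trans (+-identityʳ _) (+-identityʳ _) ⟩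
      0#                       ∎

    Δ-annihilates-kernel : ∀ {a} → ℒ a ≈ 0# → Δ * a ≈ 0#
    Δ-annihilates-kernel {a} ℒa≈0 = begin
      Δ * a                  ≈⟨ [y-z]x≈yx-zx a cubes CDE₃ ⟩
      cubes * a - CDE₃ * a   ≈⟨ x≈y⇒x∙y⁻¹≈ε cubes≈CDE₃ ⟩
      0#                     ∎
      where
      cubes = C ^ 3 + D ^ 3 + E ^ 3
      CDE₃ = three * C * D * E
      b = σ a
      c = σ b
      r₁ : combo a b c ≈ 0#
      r₁ = ℒa≈0
      r₂ : combo b c a ≈ 0#
      r₂ = trans (combo-cong refl refl (sym (σ³≈id a))) (σ-preserves-kernel ℒa≈0)
      r₃ : combo c a b ≈ 0#
      r₃ = trans (combo-cong refl (sym (σ³≈id a)) (sym (σ-cong (σ³≈id a))))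
        (σ-preserves-kernel (σ-preserves-kernel ℒa≈0))
      cubes≈CDE₃ : cubes * a ≈ CDE₃ * a
      cubes≈CDE₃ = begin
        cubes * a
          ≈⟨ +-identityˡ _ ⟨
        0# + cubes * a
          ≈⟨ +-congʳ (combo-zero (C * D) (C * E) (D * E) r₁ r₂ r₃) ⟨
        C * D * combo a b c + C * E * combo b c a + D * E * combo c a b + cubes * a
          ≈⟨ circulant-adjugate a b c ⟨
        E * E * combo a b c + D * D * combo b c a + C * C * combo c a b + CDE₃ * a
          ≈⟨ +-congʳ (combo-zero (E * E) (D * D) (C * C) r₁ r₂ r₃) ⟩
        0# + CDE₃ * a
          ≈⟨ +-identityˡ _ ⟩
        CDE₃ * a
          ∎

    module _ (2Δ≈1 : two * Δ ≈ 1#) where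

      ℒ-kernel : ∀ {a} → ℒ a ≈ 0# → a ≈ 0#
      ℒ-kernel {a} ℒa≈0 = begin
        a             ≈⟨ *-identityˡ a ⟨
        1# * a        ≈⟨ *-congʳ 2Δ≈1 ⟨
        two * Δ * a   ≈⟨ *-assoc two Δ a ⟩
        two * (Δ * a) ≈⟨ *-congˡ (Δ-annihilates-kernel ℒa≈0) ⟩
        two * 0#      ≈⟨ zeroʳ two ⟩
        0#            ∎

      ℒ-injective : Injective _≈_ _≈_ ℒ
      ℒ-injective {x} {y} ℒx≈ℒy =
        x∙y⁻¹≈ε⇒x≈y x y (ℒ-kernel (trans (ℒ-homo-- x y) (x≈y⇒x∙y⁻¹≈ε ℒx≈ℒy)))

      module _ (isField : IsField R) {N} (card : HasOrder R N) where
        open FieldProperties R isField using (*-cancelˡ; *-nonzero)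
        open FiniteSetoid card using (injective⇒surjective)

        two≉0 : two ≉ 0#
        two≉0 two≈0 = IsField.0≉1 isField (begin
          0#      ≈⟨ zeroˡ Δ ⟨
          0# * Δ  ≈⟨ *-congʳ two≈0 ⟨
          two * Δ ≈⟨ 2Δ≈1 ⟩
          1#      ∎)

        ℒ∘square-planar : Planar R (λ x → ℒ (x * x))
        ℒ∘square-planar ε ε≉0 = difference-injective , injective⇒surjective difference-cong difference-injective
          where
          difference : Carrier → Carrier
          difference x = ℒ ((x + ε) * (x + ε)) - ℒ (x * x)

          difference-cong : Congruent _≈_ _≈_ difference
          difference-cong x≈y =
            +-cong (ℒ-cong (*-cong (+-congʳ x≈y) (+-congʳ x≈y))) (-‿cong (ℒ-cong (*-cong x≈y x≈y)))

          difference≈ℒ∘affine : ∀ x → difference x ≈ ℒ (two * ε * x + ε * ε)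
          difference≈ℒ∘affine x = begin
            ℒ ((x + ε) * (x + ε)) - ℒ (x * x)  ≈⟨ ℒ-homo-- _ _ ⟨
            ℒ ((x + ε) * (x + ε) - x * x)      ≈⟨ ℒ-cong (trans (+-congʳ (square-+ x ε)) (xyx⁻¹≈y (x * x) _)) ⟩
            ℒ (two * ε * x + ε * ε)            ∎

          difference-injective : Injective _≈_ _≈_ difference
          difference-injective {u} {v} du≈dv = *-cancelˡ (*-nonzero two≉0 ε≉0) (∙-cancelʳ (ε * ε) _ _
            (ℒ-injective (trans (sym (difference≈ℒ∘affine u)) (trans du≈dv (difference≈ℒ∘affine v)))))

open import Data.Nat using (_^_) renaming (_*_ to _*ℕ_)

theorem3p1 : ∀ {c ℓ} (p k : ℕ) → Prime p → p ≢ 2 →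
    (L : CommutativeRing c ℓ) → IsField L → HasOrder L ((p ^ suc k) ^ 3) →
    let open CommutativeRing L
        q = p ^ suc k
        two = 1# + 1#
        three = 1# + 1# + 1#
    in (C D E : Carrier) →
       pow L C q ≈ C → pow L D q ≈ D → pow L E q ≈ E →
       two * (pow L C 3 + pow L D 3 + pow L E 3 - three * C * D * E) ≈ 1# →
       Planar L (λ x → E * pow L x 2 + C * pow L x (2 *ℕ q) + D * pow L x (2 *ℕ (q *ℕ q)))
theorem3p1 p k p-prime _ L isField card C D E Cq≈C Dq≈D Eq≈E 2Δ≈1 =
  Planar-cong L f≈ℒ∘square (ℒ∘square-planar 2Δ≈1 isField card)
  where
  open CommutativeRing L
  open FrobeniusCube L isField p-prime (suc k) card

  φ-fixes : ∀ {x} → pow L x q ≈ x → φ x ≈ x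
  φ-fixes {x} xq≈x = trans (reflexive (≡.sym (pow≡^ L x q))) xq≈x

  open Linearized L φ φ-cong φ-+ φ-* φ³≈id E C D (φ-fixes Eq≈E) (φ-fixes Cq≈C) (φ-fixes Dq≈D)

  f≈ℒ∘square : ∀ x → E * pow L x 2 + C * pow L x (2 *ℕ q) + D * pow L x (2 *ℕ (q *ℕ q)) ≈ ℒ (x * x)
  f≈ℒ∘square x = combo-cong (*-congˡ (*-identityʳ x)) (pow[x,2m]≈[x*x]^m L x q)
    (trans (pow[x,2m]≈[x*x]^m L x (q *ℕ q)) (sym (φ∘φ≈^[q*q] (x * x))))
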